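{- Let $k\ge 3$. For every $n\ge 1$ and all integers $i,j\ge 0$, $\varphi_k^n(ki+j)=(ki)\oplus\varphi_k^n(j)$.
   Context: The alphabet is $\mathbb{N}=\{0,1,2,\dots\}$. For an integer $k\ge 3$, $\varphi_k$ is the morphism of $\mathbb{N}^*$ defined on letters, for $i\ge 0$ and $0\le j\le k-1$, by $\varphi_k(ki+j)=(ki)(ki+j+1)$ (two letters) if $0\le j\le k-2$, and $\varphi_k(ki+k-1)=(ki+k)$ (one letter). For a finite word $W$ and integer $m$, $m\oplus W$ is the word obtained by adding $m$ to each letter of $W$. -}

module Defs where

open import Data.Nat using (ℕ; zero; suc; _+_; _*_; _∸_; NonZero)
open import Data.Nat.DivMod using (_/_; _%_)
open import Data.List using (List; []; _∷_; _++_; map; concatMap)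
open import Data.Bool using (if_then_else_)
open import Relation.Nullary.Decidable using (⌊_⌋)
open import Data.Nat using (_≟_)

-- Image of a single letter x = k*i + j (i = x / k, j = x % k) under φ_k:
--   φ_k(ki+j) = (ki)(ki+j+1)  if j ≤ k-2,
--   φ_k(ki+k-1) = (ki+k).
phiLetter : (k : ℕ) → .{{NonZero k}} → ℕ → List ℕ
phiLetter k x =
  if ⌊ x % k ≟ k ∸ 1 ⌋
  then (k * (x / k) + k) ∷ []
  else (k * (x / k)) ∷ (x + 1) ∷ []

phi : (k : ℕ) → .{{NonZero k}} → List ℕ → List ℕ
phi k w = concatMap (phiLetter k) w

phiIter : (k : ℕ) → .{{NonZero k}} → ℕ → List ℕ → List ℕ
phiIter k zero    w = w
phiIter k (suc n) w = phi k (phiIter k n w)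

_⊕_ : ℕ → List ℕ → List ℕ
m ⊕ w = map (m +_) w

-- φ_k only looks at a letter's residue and quotient mod k, so adding a multiple k*i of k
-- to a letter adds k*i to every letter of its image: φ_k commutes with the shift (k*i) ⊕_,
-- hence so does every iterate. The theorem is the case of the one-letter word j.
module Submission where

open import Defs
open import Data.Nat using (ℕ; zero; suc; _+_; _*_; _≤_; NonZero; _≟_; _∸_)
open import Data.Nat.Properties using (+-comm; +-assoc; *-comm; *-distribˡ-+)
open import Data.Nat.DivMod using (_/_; _%_; [m+kn]%n≡m%n; +-distrib-/-∣ˡ; m*n/n≡m)
open import Data.Nat.Divisibility using (m∣m*n)
open import Data.List using (List; _∷_; []; _++_; map)
open import Data.List.Properties using (map-++)
open import Data.Bool using (true; false)
open import Relation.Nullary.Decidable using (⌊_⌋)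
open import Relation.Binary.PropositionalEquality
open ≡-Reasoning

module _ (k : ℕ) .{{_ : NonZero k}} where

  [k*i+x]%k≡x%k : (i x : ℕ) → (k * i + x) % k ≡ x % k
  [k*i+x]%k≡x%k i x = begin
    (k * i + x) % k ≡⟨ cong (_% k) (+-comm (k * i) x) ⟩
    (x + k * i) % k ≡⟨ cong (λ y → (x + y) % k) (*-comm k i) ⟩
    (x + i * k) % k ≡⟨ [m+kn]%n≡m%n x i k ⟩
    x % k           ∎

  [k*i+x]/k≡i+x/k : (i x : ℕ) → (k * i + x) / k ≡ i + x / k
  [k*i+x]/k≡i+x/k i x = begin
    (k * i + x) / k     ≡⟨ +-distrib-/-∣ˡ x (m∣m*n i) ⟩
    k * i / k + x / k   ≡⟨ cong (λ y → y / k + x / k) (*-comm k i) ⟩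
    i * k / k + x / k   ≡⟨ cong (_+ x / k) (m*n/n≡m i k) ⟩
    i + x / k           ∎

  phiLetter-shift : (i x : ℕ) → phiLetter k (k * i + x) ≡ (k * i) ⊕ phiLetter k x
  phiLetter-shift i x
    rewrite [k*i+x]%k≡x%k i x | [k*i+x]/k≡i+x/k i x
    with ⌊ x % k ≟ k ∸ 1 ⌋
  ... | true  = cong (_∷ []) (begin
    k * (i + x / k) + k       ≡⟨ cong (_+ k) (*-distribˡ-+ k i (x / k)) ⟩
    k * i + k * (x / k) + k   ≡⟨ +-assoc (k * i) (k * (x / k)) k ⟩
    k * i + (k * (x / k) + k) ∎)
  ... | false = cong₂ _∷_ (*-distribˡ-+ k i (x / k)) (cong (_∷ []) (+-assoc (k * i) x 1))

  phi-shift : (i : ℕ) (w : List ℕ) → phi k ((k * i) ⊕ w) ≡ (k * i) ⊕ phi k w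
  phi-shift i []      = refl
  phi-shift i (x ∷ w) = begin
    phiLetter k (k * i + x) ++ phi k ((k * i) ⊕ w)   ≡⟨ cong₂ _++_ (phiLetter-shift i x) (phi-shift i w) ⟩
    (k * i) ⊕ phiLetter k x ++ (k * i) ⊕ phi k w     ≡⟨ map-++ (k * i +_) (phiLetter k x) (phi k w) ⟨
    (k * i) ⊕ (phiLetter k x ++ phi k w)             ∎

  phiIter-shift : (i n : ℕ) (w : List ℕ) → phiIter k n ((k * i) ⊕ w) ≡ (k * i) ⊕ phiIter k n w
  phiIter-shift i zero    w = refl
  phiIter-shift i (suc n) w = begin
    phi k (phiIter k n ((k * i) ⊕ w)) ≡⟨ cong (phi k) (phiIter-shift i n w) ⟩
    phi k ((k * i) ⊕ phiIter k n w)   ≡⟨ phi-shift i (phiIter k n w) ⟩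
    (k * i) ⊕ phiIter k (suc n) w     ∎

theorem3p2 : (k : ℕ) → .{{_ : NonZero k}} → 3 ≤ k → (n : ℕ) → 1 ≤ n → (i j : ℕ)
    → phiIter k n ((k * i + j) ∷ []) ≡ (k * i) ⊕ phiIter k n (j ∷ [])
theorem3p2 k _ n _ i j = phiIter-shift k i n (j ∷ [])
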